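{- Let $T$ be a tournament with $V(T)=[n]$, let $\alpha\in(0,1)$ and let $t>0$ be an integer. Suppose that $e_1=\overrightarrow{v_1u_1},\dots,e_t=\overrightarrow{v_tu_t}\in E(T)$ are $\alpha$-long backedges such that $\{e_1,\dots,e_t\}$ is a matching (the edges are pairwise vertex-disjoint) and the subtournament of $T$ induced by $\{u_1,v_1,\dots,u_t,v_t\}$ is transitive. Then $T$ contains at least $\binom{\alpha t+1}{2}$ backedges.
   Context: A backedge of a tournament on $[n]$ is an arc $\overrightarrow{vu}$ with $v>u$. For $\alpha>0$, a backedge $\overrightarrow{vu}$ is $\alpha$-long if $v-u\ge\alpha n$. Here $\binom{x}{2}=x(x-1)/2$ for real $x$.
   Formalization: The parameter α ranges only over rational numbers in $(0,1)$. -}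

module Defs where

open import Data.Nat using (ℕ; _+_; _*_; _<_; _<ᵇ_)
open import Data.Fin using (Fin; toℕ)
open import Data.Bool using (Bool; true; false; _∧_; if_then_else_)
open import Data.List using (map; allFin)
open import Data.Nat.ListAction using (sum)
open import Data.Product using (∃; _×_)
open import Data.Sum using (_⊎_)
open import Relation.Binary.PropositionalEquality using (_≡_; _≢_)
open import Relation.Nullary using (¬_)

-- A tournament on the vertex set [n], represented by Fin n
-- (vertex k ∈ Fin n stands for k+1 ∈ [n]; only differences/order matter).
-- arc v u ≡ true means the arc v → u is present.
record Tournament (n : ℕ) : Set where
  field
    arc        : Fin n → Fin n → Bool
    irrefl     : ∀ v → arc v v ≡ false
    total      : ∀ u v → u ≢ v → arc u v ≡ true ⊎ arc v u ≡ true
    antisym    : ∀ u v → arc u v ≡ true → arc v u ≡ false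
open Tournament public

backedgeCount : ∀ {n} → Tournament n → ℕ
backedgeCount {n} T =
  sum (map (λ v → sum (map (λ u → if (toℕ u <ᵇ toℕ v) ∧ arc T v u then 1 else 0)
                              (allFin n)))
           (allFin n))

InducedTransitive : ∀ {n} → Tournament n → (Fin n → Set) → Set
InducedTransitive {n} T S =
  ∀ (a b c : Fin n) → S a → S b → S c →
    arc T a b ≡ true → arc T b c ≡ true → arc T a c ≡ true

{-# OPTIONS --safe #-}
module Submission where

-- Call the depth of a vertex x the number of edges e_i whose span [u_i, v_i) contains x.
-- The spans have total length at least α n t, so some vertex has depth k ≥ α t. For two edges
-- e_i, e_j spanning a common vertex, u_j < v_i and u_i < v_j, and transitivity forces v_i → u_j
-- or v_j → u_i (otherwise v_i → u_i → v_j and v_j → u_j → v_i); either is a backedge. As the e_i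
-- form a matching, these backedges and the e_i themselves are distinct: k(k+1)/2 in all.

open import Defs
open import Data.Bool using (true; false; _∧_; if_then_else_)
open import Data.Fin using (Fin; zero; suc; toℕ; fromℕ<; punchIn; punchOut; _≟_)
open import Data.Fin.Properties
  using (toℕ<n; suc-injective; punchInᵢ≢i; punchOut-injective; punchIn-punchOut)
open import Data.List using (map; allFin; tabulate)
open import Data.List.Properties using (map-tabulate)
open import Data.Nat
  using (ℕ; zero; suc; _+_; _*_; _∸_; _<_; _≤_; _<ᵇ_; z≤n; s≤s; z<s; s<s; _≤?_; _<?_; >-nonZero)
import Data.Nat.ListAction as List
open import Data.Nat.Properties hiding (_≟_; suc-injective)
open import Algebra.Properties.Semiring.Sum +-*-semiring
  using (sum; sum-syntax; sum-cong-≗; sum-remove; sum-replicate-zero; ∑-distrib-+; ∑-comm;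
         *-distribˡ-sum; *-distribʳ-sum)
open import Algebra.Properties.CommutativeSemigroup *-commutativeSemigroup
  using (xy∙z≈y∙xz; x∙yz≈xz∙y; x∙yz≈yx∙z)
open import Data.Nat.Tactic.RingSolver using (solve-∀)
open import Data.Product using (∃; _×_; _,_; proj₁; proj₂)
open import Data.Sum using (_⊎_; inj₁; inj₂)
open import Function using (_∘_; id)
open import Function.Definitions using (Injective)
open import Relation.Binary.PropositionalEquality
open import Relation.Nullary using (¬_; Dec; yes; no; contradiction)
open import Relation.Nullary.Decidable using (_×-dec_; decidable-stable)

indicator : ∀ {P : Set} → Dec P → ℕ
indicator (yes _) = 1
indicator (no _)  = 0

indicator-yes : ∀ {P : Set} (d : Dec P) → P → indicator d ≡ 1
indicator-yes (yes _) _ = refl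
indicator-yes (no ¬p) p = contradiction p ¬p

indicator-no : ∀ {P : Set} (d : Dec P) → ¬ P → indicator d ≡ 0
indicator-no (yes p) ¬p = contradiction p ¬p
indicator-no (no _)  _  = refl

≢-preserving⇒injective : ∀ {m} {A : Set} (g : Fin m → A) →
                         (∀ {i j} → i ≢ j → g i ≢ g j) → Injective _≡_ _≡_ g
≢-preserving⇒injective g g-≢ {i} {j} gi≡gj =
  decidable-stable (i ≟ j) (λ i≢j → g-≢ i≢j gi≡gj)

sum-tabulate : ∀ {n} (f : Fin n → ℕ) → List.sum (tabulate f) ≡ sum f
sum-tabulate {zero}  f = refl
sum-tabulate {suc n} f = cong (f zero +_) (sum-tabulate (f ∘ suc))

sum-allFin : ∀ n (f : Fin n → ℕ) → List.sum (map f (allFin n)) ≡ sum f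
sum-allFin n f = trans (cong List.sum (map-tabulate id f)) (sum-tabulate f)

sum-mono-≤ : ∀ {n} {f g : Fin n → ℕ} → (∀ i → f i ≤ g i) → sum f ≤ sum g
sum-mono-≤ {zero}  _   = z≤n
sum-mono-≤ {suc n} f≤g = +-mono-≤ (f≤g zero) (sum-mono-≤ (f≤g ∘ suc))

sum-const : ∀ n c → ∑[ i < n ] c ≡ n * c
sum-const zero    c = refl
sum-const (suc n) c = cong (c +_) (sum-const n c)

∑-indicator-≡ : ∀ {n} (i : Fin n) → ∑[ j < n ] indicator (i ≟ j) ≡ 1
∑-indicator-≡ {suc n} i = begin
  ∑[ j < suc n ] indicator (i ≟ j)
    ≡⟨ sum-remove {i = i} (indicator ∘ (i ≟_)) ⟩
  indicator (i ≟ i) + ∑[ j < n ] indicator (i ≟ punchIn i j)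
    ≡⟨ cong₂ _+_ (indicator-yes (i ≟ i) refl)
                 (sum-cong-≗ (λ j → indicator-no (i ≟ punchIn i j) (punchInᵢ≢i i j ∘ sym))) ⟩
  1 + ∑[ j < n ] 0
    ≡⟨ cong suc (sum-replicate-zero n) ⟩
  1 ∎
  where open ≡-Reasoning

∑∑-product-plus-diagonal : ∀ {t} (c : Fin t → ℕ) →
  ∑[ i < t ] ∑[ j < t ] (c i * (c j + indicator (i ≟ j))) ≡ sum c * (sum c + 1)
∑∑-product-plus-diagonal {t} c = begin
  ∑[ i < t ] ∑[ j < t ] (c i * (c j + indicator (i ≟ j)))
    ≡⟨ sum-cong-≗ (λ i → *-distribˡ-sum (c i) (λ j → c j + indicator (i ≟ j))) ⟨
  ∑[ i < t ] (c i * ∑[ j < t ] (c j + indicator (i ≟ j)))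
    ≡⟨ sum-cong-≗ (λ i → cong (c i *_) (∑-distrib-+ c (indicator ∘ (i ≟_)))) ⟩
  ∑[ i < t ] (c i * (sum c + ∑[ j < t ] indicator (i ≟ j)))
    ≡⟨ sum-cong-≗ (λ i → cong (λ m → c i * (sum c + m)) (∑-indicator-≡ i)) ⟩
  ∑[ i < t ] (c i * (sum c + 1))
    ≡⟨ *-distribʳ-sum (sum c + 1) c ⟨
  sum c * (sum c + 1) ∎
  where open ≡-Reasoning

∑∑-symmetrised : ∀ {t} (F : Fin t → Fin t → ℕ) →
  ∑[ i < t ] ∑[ j < t ] (F i j + F j i) ≡ 2 * ∑[ i < t ] ∑[ j < t ] F i j
∑∑-symmetrised {t} F = begin
  ∑[ i < t ] ∑[ j < t ] (F i j + F j i)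
    ≡⟨ sum-cong-≗ (λ i → ∑-distrib-+ (F i) (λ j → F j i)) ⟩
  ∑[ i < t ] (∑[ j < t ] F i j + ∑[ j < t ] F j i)
    ≡⟨ ∑-distrib-+ (λ i → ∑[ j < t ] F i j) (λ i → ∑[ j < t ] F j i) ⟩
  ∑∑F + ∑[ i < t ] ∑[ j < t ] F j i
    ≡⟨ cong (∑∑F +_) (∑-comm (λ i j → F j i)) ⟩
  ∑∑F + ∑∑F
    ≡⟨ cong (∑∑F +_) (+-identityʳ ∑∑F) ⟨
  2 * ∑∑F ∎
  where
  open ≡-Reasoning
  ∑∑F : ℕ
  ∑∑F = ∑[ i < t ] ∑[ j < t ] F i j

sum-∘-injective-≤ : ∀ {m n} (g : Fin m → Fin n) → Injective _≡_ _≡_ g →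
                    (f : Fin n → ℕ) → sum (f ∘ g) ≤ sum f
sum-∘-injective-≤ {zero}          g _ f = z≤n
sum-∘-injective-≤ {suc m} {zero}  g _ f with g zero
... | ()
sum-∘-injective-≤ {suc m} {suc n} g g-inj f = begin
  f (g zero) + sum (f ∘ g ∘ suc)
    ≡⟨ cong (f (g zero) +_) (sum-cong-≗ (λ i → cong f (sym (punchIn-punchOut (g₀≢ i))))) ⟩
  f (g zero) + sum (f ∘ punchIn (g zero) ∘ g′)
    ≤⟨ +-monoʳ-≤ (f (g zero)) (sum-∘-injective-≤ g′ g′-inj (f ∘ punchIn (g zero))) ⟩
  f (g zero) + sum (f ∘ punchIn (g zero))
    ≡⟨ sum-remove f ⟨
  sum f ∎
  where
  open ≤-Reasoning
  g₀≢ : ∀ i → g zero ≢ g (suc i)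
  g₀≢ i g₀≡ with g-inj g₀≡
  ... | ()
  g′ : Fin m → Fin n
  g′ i = punchOut (g₀≢ i)
  g′-inj : Injective _≡_ _≡_ g′
  g′-inj {i} {j} e = suc-injective (g-inj (punchOut-injective (g₀≢ i) (g₀≢ j) e))

interval-length≤sum : ∀ {n} (f : Fin n → ℕ) lo hi → hi ≤ n →
                      (∀ y → lo ≤ toℕ y → toℕ y < hi → 1 ≤ f y) → hi ∸ lo ≤ sum f
interval-length≤sum f lo zero _ _ = ≤-trans (≤-reflexive (0∸n≡0 lo)) z≤n
interval-length≤sum {suc n} f zero (suc hi) (s≤s hi≤n) f-pos =
  +-mono-≤ (f-pos zero z≤n z<s)
           (interval-length≤sum (f ∘ suc) zero hi hi≤n
              (λ y _ y<hi → f-pos (suc y) z≤n (s<s y<hi)))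
interval-length≤sum {suc n} f (suc lo) (suc hi) (s≤s hi≤n) f-pos =
  ≤-trans (interval-length≤sum (f ∘ suc) lo hi hi≤n
             (λ y lo≤y y<hi → f-pos (suc y) (s≤s lo≤y) (s<s y<hi)))
          (m≤n+m _ _)

argmax : ∀ {n} (f : Fin (suc n) → ℕ) → ∃ λ x → ∀ y → f y ≤ f x
argmax {zero}  f = zero , λ { zero → ≤-refl }
argmax {suc n} f with argmax (f ∘ suc)
... | x , f≤fx with f zero ≤? f (suc x)
...   | yes f₀≤ = suc x , λ { zero → f₀≤ ; (suc y) → f≤fx y }
...   | no  f₀≰ = zero  , λ { zero → ≤-refl ; (suc y) → ≤-trans (f≤fx y) (≰⇒≥ f₀≰) }

∃-≥-average : ∀ {n} → Fin n → (f : Fin n → ℕ) → ∃ λ x → sum f ≤ n * f x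
∃-≥-average {suc n} _ f with argmax f
... | x , f≤fx = x , ≤-trans (sum-mono-≤ f≤fx) (≤-reflexive (sum-const (suc n) (f x)))

module _ {n} (T : Tournament n) where

  backedgeIndicator : Fin n → Fin n → ℕ
  backedgeIndicator v u = if (toℕ u <ᵇ toℕ v) ∧ arc T v u then 1 else 0

  backedgeIndicator≡1 : ∀ {v u} → toℕ u < toℕ v → arc T v u ≡ true →
                        backedgeIndicator v u ≡ 1
  backedgeIndicator≡1 {v} {u} u<v vu with toℕ u <ᵇ toℕ v | <⇒<ᵇ u<v
  ... | true  | _ rewrite vu = refl
  ... | false | ()

  backedgeCount≡∑∑ : backedgeCount T ≡ ∑[ v < n ] ∑[ u < n ] backedgeIndicator v u
  backedgeCount≡∑∑ =
    trans (sum-allFin n _) (sum-cong-≗ (λ v → sum-allFin n (backedgeIndicator v)))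

  ∑∑backedgeIndicator≤backedgeCount :
    ∀ {s t} (v : Fin s → Fin n) (u : Fin t → Fin n) →
    Injective _≡_ _≡_ v → Injective _≡_ _≡_ u →
    ∑[ i < s ] ∑[ j < t ] backedgeIndicator (v i) (u j) ≤ backedgeCount T
  ∑∑backedgeIndicator≤backedgeCount v u v-inj u-inj = begin
    ∑[ i < _ ] ∑[ j < _ ] backedgeIndicator (v i) (u j)
      ≤⟨ sum-mono-≤ (λ i → sum-∘-injective-≤ u u-inj (backedgeIndicator (v i))) ⟩
    ∑[ i < _ ] ∑[ y < n ] backedgeIndicator (v i) y
      ≤⟨ sum-∘-injective-≤ v v-inj (λ x → ∑[ y < n ] backedgeIndicator x y) ⟩
    ∑[ x < n ] ∑[ y < n ] backedgeIndicator x y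
      ≡⟨ backedgeCount≡∑∑ ⟨
    backedgeCount T ∎
    where open ≤-Reasoning

  transitive⇒cross-arc : ∀ (S : Fin n → Set) → InducedTransitive T S → ∀ {a b c d} →
    S a → S b → S c → S d → arc T a b ≡ true → arc T c d ≡ true → d ≢ a → b ≢ c →
    arc T a d ≡ true ⊎ arc T c b ≡ true
  transitive⇒cross-arc S trans-S {a} {b} {c} {d} Sa Sb Sc Sd ab cd d≢a b≢c
    with total T d a d≢a | total T b c b≢c
  ... | inj₂ ad | _       = inj₁ ad
  ... | inj₁ _  | inj₂ cb = inj₂ cb
  ... | inj₁ da | inj₁ bc = contradiction (trans (sym (antisym T a c ac)) ca) λ ()
    where
    ac = trans-S a b c Sa Sb Sc ab bc
    ca = trans-S c d a Sc Sd Sa cd da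

module BackedgeMatching {n t} (T : Tournament n) (v u : Fin t → Fin n)
  (arc-vu : ∀ i → arc T (v i) (u i) ≡ true)
  (u<v : ∀ i → toℕ (u i) < toℕ (v i))
  (v-injective : Injective _≡_ _≡_ v)
  (u-injective : Injective _≡_ _≡_ u)
  (transitive : InducedTransitive T (λ x → ∃ λ i → (x ≡ v i) ⊎ (x ≡ u i))) where

  backedge-vu : Fin t → Fin t → ℕ
  backedge-vu i j = backedgeIndicator T (v i) (u j)

  _spans_ : Fin t → Fin n → Set
  i spans x = toℕ (u i) ≤ toℕ x × toℕ x < toℕ (v i)

  _spans?_ : ∀ i x → Dec (i spans x)
  i spans? x = (toℕ (u i) ≤? toℕ x) ×-dec (toℕ x <? toℕ (v i))

  χ : Fin t → Fin n → ℕ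
  χ i x = indicator (i spans? x)

  depth : Fin n → ℕ
  depth x = ∑[ i < t ] χ i x

  span-length : Fin t → ℕ
  span-length i = toℕ (v i) ∸ toℕ (u i)

  backedge-vu-diagonal : ∀ i → backedge-vu i i ≡ 1
  backedge-vu-diagonal i = backedgeIndicator≡1 T (u<v i) (arc-vu i)

  backedge-vu-cross : ∀ {i j x} → i spans x → j spans x → 1 ≤ backedge-vu i j + backedge-vu j i
  backedge-vu-cross {i} {j} (uᵢ≤x , x<vᵢ) (uⱼ≤x , x<vⱼ) =
    one-is-backedge (transitive⇒cross-arc T _ transitive
      (i , inj₁ refl) (i , inj₂ refl) (j , inj₁ refl) (j , inj₂ refl)
      (arc-vu i) (arc-vu j) (<⇒≢ uⱼ<vᵢ ∘ cong toℕ) (<⇒≢ uᵢ<vⱼ ∘ cong toℕ))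
    where
    uⱼ<vᵢ : toℕ (u j) < toℕ (v i)
    uⱼ<vᵢ = ≤-<-trans uⱼ≤x x<vᵢ
    uᵢ<vⱼ : toℕ (u i) < toℕ (v j)
    uᵢ<vⱼ = ≤-<-trans uᵢ≤x x<vⱼ
    one-is-backedge : arc T (v i) (u j) ≡ true ⊎ arc T (v j) (u i) ≡ true →
                      1 ≤ backedge-vu i j + backedge-vu j i
    one-is-backedge (inj₁ vᵢuⱼ) =
      ≤-trans (≤-reflexive (sym (backedgeIndicator≡1 T uⱼ<vᵢ vᵢuⱼ))) (m≤m+n _ _)
    one-is-backedge (inj₂ vⱼuᵢ) =
      ≤-trans (≤-reflexive (sym (backedgeIndicator≡1 T uᵢ<vⱼ vⱼuᵢ))) (m≤n+m _ _)

  spans-pair≤backedges : ∀ x i j →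
    χ i x * (χ j x + indicator (i ≟ j)) ≤ backedge-vu i j + backedge-vu j i
  spans-pair≤backedges x i j with i spans? x
  ... | no _ = z≤n
  ... | yes i-spans with i ≟ j
  ...   | yes refl rewrite indicator-yes (i spans? x) i-spans | backedge-vu-diagonal i = ≤-refl
  ...   | no _ with j spans? x
  ...     | no _        = z≤n
  ...     | yes j-spans = backedge-vu-cross i-spans j-spans

  depth-bound : ∀ x → depth x * (depth x + 1) ≤ 2 * backedgeCount T
  depth-bound x = begin
    depth x * (depth x + 1)
      ≡⟨ ∑∑-product-plus-diagonal (λ i → χ i x) ⟨
    ∑[ i < t ] ∑[ j < t ] (χ i x * (χ j x + indicator (i ≟ j)))
      ≤⟨ sum-mono-≤ (λ i → sum-mono-≤ (spans-pair≤backedges x i)) ⟩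
    ∑[ i < t ] ∑[ j < t ] (backedge-vu i j + backedge-vu j i)
      ≡⟨ ∑∑-symmetrised backedge-vu ⟩
    2 * ∑[ i < t ] ∑[ j < t ] backedge-vu i j
      ≤⟨ *-monoʳ-≤ 2 (∑∑backedgeIndicator≤backedgeCount T v u v-injective u-injective) ⟩
    2 * backedgeCount T ∎
    where open ≤-Reasoning

  ∑span-length≤∑depth : ∑[ i < t ] span-length i ≤ ∑[ x < n ] depth x
  ∑span-length≤∑depth = begin
    ∑[ i < t ] span-length i
      ≤⟨ sum-mono-≤ (λ i → interval-length≤sum (χ i) _ _ (<⇒≤ (toℕ<n (v i)))
                             (λ x uᵢ≤x x<vᵢ → ≤-reflexive (sym (indicator-yes _ (uᵢ≤x , x<vᵢ))))) ⟩
    ∑[ i < t ] ∑[ x < n ] χ i x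
      ≡⟨ ∑-comm χ ⟩
    ∑[ x < n ] depth x ∎
    where open ≤-Reasoning

  ∃-deep-vertex : ∀ p q → (∀ i → p * n ≤ q * span-length i) → 0 < t →
                  ∃ λ x → p * t ≤ q * depth x
  ∃-deep-vertex p q long 0<t with ∃-≥-average (v (fromℕ< 0<t)) depth
  ... | x , ∑depth≤ = x , *-cancelʳ-≤ (p * t) (q * depth x) n {{>-nonZero 0<n}} (begin
    p * t * n                    ≡⟨ xy∙z≈y∙xz p t n ⟩
    t * (p * n)                  ≡⟨ sum-const t (p * n) ⟨
    ∑[ i < t ] (p * n)           ≤⟨ sum-mono-≤ long ⟩
    ∑[ i < t ] (q * span-length i) ≡⟨ *-distribˡ-sum q span-length ⟨
    q * ∑[ i < t ] span-length i ≤⟨ *-monoʳ-≤ q (≤-trans ∑span-length≤∑depth ∑depth≤) ⟩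
    q * (n * depth x)            ≡⟨ x∙yz≈xz∙y q n (depth x) ⟩
    q * depth x * n              ∎)
    where
    open ≤-Reasoning
    0<n : 0 < n
    0<n = ≤-<-trans z≤n (toℕ<n x)

claim6p2 : (n : ℕ) (T : Tournament n) (p q : ℕ) → 0 < p → p < q →
    (t : ℕ) → 0 < t → (v u : Fin t → Fin n) →
    (∀ i → arc T (v i) (u i) ≡ true) →
    (∀ i → toℕ (u i) < toℕ (v i)) →
    (∀ i → p * n ≤ q * (toℕ (v i) ∸ toℕ (u i))) →
    (∀ i j → i ≢ j → (v i ≢ v j) × (v i ≢ u j) × (u i ≢ v j) × (u i ≢ u j)) →
    InducedTransitive T (λ x → ∃ λ i → (x ≡ v i) ⊎ (x ≡ u i)) →
    (p * t + q) * (p * t) ≤ 2 * (q * q) * backedgeCount T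
claim6p2 n T p q _ _ t 0<t v u arc-vu u<v long disjoint transitive =
  conclude (∃-deep-vertex p q long 0<t)
  where
  open BackedgeMatching T v u arc-vu u<v
    (≢-preserving⇒injective v (λ {i} {j} i≢j → proj₁ (disjoint i j i≢j)))
    (≢-preserving⇒injective u (λ {i} {j} i≢j → proj₂ (proj₂ (proj₂ (disjoint i j i≢j)))))
    transitive
  open ≤-Reasoning
  factor : ∀ q k → (q * k + q) * (q * k) ≡ q * q * (k * (k + 1))
  factor = solve-∀
  conclude : (∃ λ x → p * t ≤ q * depth x) →
             (p * t + q) * (p * t) ≤ 2 * (q * q) * backedgeCount T
  conclude (x , pt≤qk) = begin
    (p * t + q) * (p * t)          ≤⟨ *-mono-≤ (+-monoˡ-≤ q pt≤qk) pt≤qk ⟩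
    (q * k + q) * (q * k)          ≡⟨ factor q k ⟩
    q * q * (k * (k + 1))          ≤⟨ *-monoʳ-≤ (q * q) (depth-bound x) ⟩
    q * q * (2 * backedgeCount T)  ≡⟨ x∙yz≈yx∙z (q * q) 2 (backedgeCount T) ⟩
    2 * (q * q) * backedgeCount T  ∎
    where
    k : ℕ
    k = depth x
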